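{- For an indeterminate (or any rational number) $n$, define $p = (n+1)(n^{14}+8n^{13}+32n^{12}+90n^{11}+195n^{10}+320n^9+391n^8+358n^7+254n^6+146n^5+71n^4+30n^3+12n^2+4n+1)$, $q = n(n+1)(n^4+3n^3+3n^2+3n+1)(n^4+2n^3-n-1)(n^5+5n^4+8n^3+5n^2+n+1)$, $r = n(n+1)^4(n^4+3n^3+3n^2+3n+1)(n^6+4n^5+9n^4+6n^3+3n^2+2n+1)$, $s = (n^4+2n^3-n-1)(n^5+5n^4+8n^3+5n^2+n+1)(n^6+2n^5+2n^4+2n^3+3n^2+2n+1)$. Then $pq(p^2+q^2) = rs(r^2+s^2)$; equivalently, with $A=p+q$, $B=r-s$, $C=p-q$, $D=r+s$, one has $A^4 + B^4 = C^4 + D^4$. -}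

module Defs where

open import Data.Nat.Base using (ℕ; zero; suc)
open import Data.Rational.Base using (ℚ; _+_; _*_; _-_; 1ℚ)
open import Agda.Builtin.FromNat using (Number; fromNat)
open import Data.Rational.Literals using (number)
import Data.Nat.Literals as NL
open import Data.Unit.Base using (⊤; tt)

instance
  ℚ-number = number
  ℕ-number : Number ℕ
  ℕ-number = NL.number

infixr 8 _^_

_^_ : ℚ → ℕ → ℚ
x ^ zero  = 1ℚ
x ^ suc k = x * (x ^ k)

pP : ℚ → ℚ
pP n = (n + 1) * (n ^ 14 + 8 * n ^ 13 + 32 * n ^ 12 + 90 * n ^ 11 + 195 * n ^ 10
        + 320 * n ^ 9 + 391 * n ^ 8 + 358 * n ^ 7 + 254 * n ^ 6 + 146 * n ^ 5
        + 71 * n ^ 4 + 30 * n ^ 3 + 12 * n ^ 2 + 4 * n + 1)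

qQ : ℚ → ℚ
qQ n = n * (n + 1) * (n ^ 4 + 3 * n ^ 3 + 3 * n ^ 2 + 3 * n + 1)
       * (n ^ 4 + 2 * n ^ 3 - n - 1)
       * (n ^ 5 + 5 * n ^ 4 + 8 * n ^ 3 + 5 * n ^ 2 + n + 1)

rR : ℚ → ℚ
rR n = n * (n + 1) ^ 4 * (n ^ 4 + 3 * n ^ 3 + 3 * n ^ 2 + 3 * n + 1)
       * (n ^ 6 + 4 * n ^ 5 + 9 * n ^ 4 + 6 * n ^ 3 + 3 * n ^ 2 + 2 * n + 1)

sS : ℚ → ℚ
sS n = (n ^ 4 + 2 * n ^ 3 - n - 1)
       * (n ^ 5 + 5 * n ^ 4 + 8 * n ^ 3 + 5 * n ^ 2 + n + 1)
       * (n ^ 6 + 2 * n ^ 5 + 2 * n ^ 4 + 2 * n ^ 3 + 3 * n ^ 2 + 2 * n + 1)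

module Submission where

-- (1) p q (p² + q²) = r s (r² + s²) is an identity between polynomials of
--     degree 60 in n.  We decide it by normalisation: the standard
--     library's Horner-form ring solver (Algebra.Solver.Ring) is
--     instantiated for ℚ with coefficients in ℤ, embedded by fromℤ.  With
--     integer coefficients the normal forms compute quickly, so the two
--     sides are seen to have the same normal form by evaluation.  For this
--     we show that fromℤ is a ring morphism and transcribe p, q, r, s into
--     the solver's expression language.
-- (2) The quartic identity is a consequence of (1) alone: in any
--     commutative ring (a + b)⁴ - (a - b)⁴ = 8ab(a² + b²), so two pairs
--     (a, b), (c, d) with ab(a² + b²) = cd(c² + d²) satisfy
--     (a + b)⁴ + (c - d)⁴ = (a - b)⁴ + (c + d)⁴.

open import Defs
open import Agda.Builtin.FromNat using (Number; fromNat)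
open import Data.Unit.Base using (⊤)
open import Data.Product using (_×_; _,_)
open import Data.Fin.Base using (zero; suc)
open import Data.Vec.Base using (_∷_; [])
open import Data.Maybe.Base using (map)
open import Data.Integer.Base as ℤ using (ℤ; +_)
import Data.Integer.Properties as ℤ
open import Data.Rational.Base using (ℚ; _+_; _*_; _-_; -_)
open import Data.Rational.Literals using (fromℤ)
import Data.Rational.Unnormalised.Base as ℚᵘ
import Data.Rational.Unnormalised.Properties as ℚᵘ
open import Data.Rational.Properties
  using (+-*-commutativeRing; +-assoc; +-comm; toℚᵘ-injective; toℚᵘ-homo-+; toℚᵘ-homo-*; toℚᵘ-homo‿-)
open import Algebra.Solver.Ring.AlmostCommutativeRing
  using (AlmostCommutativeRing; fromCommutativeRing; _-Raw-AlmostCommutative⟶_)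
open import Relation.Nullary.Decidable.Core using (dec⇒maybe)
open import Relation.Binary.PropositionalEquality
  using (_≡_; refl; sym; trans; cong; cong₂; module ≡-Reasoning)

-- Each law is transported from the unnormalised rationals, where both
-- sides have denominator 1 and agree up to multiplication by 1.

fromℤ-homo-+ : ∀ i j → fromℤ (i ℤ.+ j) ≡ fromℤ i + fromℤ j
fromℤ-homo-+ i j =
  toℚᵘ-injective (ℚᵘ.≃-trans (ℚᵘ.*≡* cross) (ℚᵘ.≃-sym (toℚᵘ-homo-+ (fromℤ i) (fromℤ j))))
  where
  cross : (i ℤ.+ j) ℤ.* + 1 ≡ (i ℤ.* + 1 ℤ.+ j ℤ.* + 1) ℤ.* + 1
  cross = trans (ℤ.*-identityʳ _)
    (sym (trans (ℤ.*-identityʳ _) (cong₂ ℤ._+_ (ℤ.*-identityʳ i) (ℤ.*-identityʳ j))))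

fromℤ-homo-* : ∀ i j → fromℤ (i ℤ.* j) ≡ fromℤ i * fromℤ j
fromℤ-homo-* i j =
  toℚᵘ-injective (ℚᵘ.≃-trans (ℚᵘ.*≡* refl) (ℚᵘ.≃-sym (toℚᵘ-homo-* (fromℤ i) (fromℤ j))))

fromℤ-homo-neg : ∀ i → fromℤ (ℤ.- i) ≡ - fromℤ i
fromℤ-homo-neg i =
  toℚᵘ-injective (ℚᵘ.≃-trans (ℚᵘ.*≡* refl) (ℚᵘ.≃-sym (toℚᵘ-homo‿- (fromℤ i))))

ℚ-ring : AlmostCommutativeRing _ _
ℚ-ring = fromCommutativeRing +-*-commutativeRing

fromℤ-morphism : ℤ.+-*-rawRing -Raw-AlmostCommutative⟶ ℚ-ring
fromℤ-morphism = record
  { ⟦_⟧    = fromℤ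
  ; +-homo = fromℤ-homo-+
  ; *-homo = fromℤ-homo-*
  ; -‿homo = fromℤ-homo-neg
  ; 0-homo = refl
  ; 1-homo = refl
  }

open import Algebra.Solver.Ring ℤ.+-*-rawRing ℚ-ring fromℤ-morphism
  (λ i j → map (cong fromℤ) (dec⇒maybe (i ℤ.≟ j)))

instance
  polynomial-number : ∀ {m} → Number (Polynomial m)
  polynomial-number = record { Constraint = λ _ → ⊤ ; fromNat = λ k → con (+ k) }

-- The polynomials p, q, r, s of Defs, written in the solver's language.
-- Evaluating pᵉ (var zero) at n gives pP n definitionally, and so on.

pᵉ qᵉ rᵉ sᵉ : Polynomial 1 → Polynomial 1
pᵉ n = (n :+ 1) :* (n :^ 14 :+ 8 :* n :^ 13 :+ 32 :* n :^ 12 :+ 90 :* n :^ 11 :+ 195 :* n :^ 10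
       :+ 320 :* n :^ 9 :+ 391 :* n :^ 8 :+ 358 :* n :^ 7 :+ 254 :* n :^ 6 :+ 146 :* n :^ 5
       :+ 71 :* n :^ 4 :+ 30 :* n :^ 3 :+ 12 :* n :^ 2 :+ 4 :* n :+ 1)
qᵉ n = n :* (n :+ 1) :* (n :^ 4 :+ 3 :* n :^ 3 :+ 3 :* n :^ 2 :+ 3 :* n :+ 1)
       :* (n :^ 4 :+ 2 :* n :^ 3 :- n :- 1)
       :* (n :^ 5 :+ 5 :* n :^ 4 :+ 8 :* n :^ 3 :+ 5 :* n :^ 2 :+ n :+ 1)
rᵉ n = n :* (n :+ 1) :^ 4 :* (n :^ 4 :+ 3 :* n :^ 3 :+ 3 :* n :^ 2 :+ 3 :* n :+ 1)
       :* (n :^ 6 :+ 4 :* n :^ 5 :+ 9 :* n :^ 4 :+ 6 :* n :^ 3 :+ 3 :* n :^ 2 :+ 2 :* n :+ 1)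
sᵉ n = (n :^ 4 :+ 2 :* n :^ 3 :- n :- 1)
       :* (n :^ 5 :+ 5 :* n :^ 4 :+ 8 :* n :^ 3 :+ 5 :* n :^ 2 :+ n :+ 1)
       :* (n :^ 6 :+ 2 :* n :^ 5 :+ 2 :* n :^ 4 :+ 2 :* n :^ 3 :+ 3 :* n :^ 2 :+ 2 :* n :+ 1)

biquadratic : ℚ → ℚ → ℚ
biquadratic x y = x * y * (x ^ 2 + y ^ 2)

biquadratic-pq≡rs : ∀ n → biquadratic (pP n) (qQ n) ≡ biquadratic (rR n) (sS n)
biquadratic-pq≡rs n = prove (n ∷ [])
  (pᵉ x :* qᵉ x :* (pᵉ x :^ 2 :+ qᵉ x :^ 2))
  (rᵉ x :* sᵉ x :* (rᵉ x :^ 2 :+ sᵉ x :^ 2))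
  refl
  where x = var zero

sum⁴≡difference⁴+8biquadratic : ∀ a b → (a + b) ^ 4 ≡ (a - b) ^ 4 + 8 * biquadratic a b
sum⁴≡difference⁴+8biquadratic a b = prove (a ∷ b ∷ [])
  ((x :+ y) :^ 4)
  ((x :- y) :^ 4 :+ 8 :* (x :* y :* (x :^ 2 :+ y :^ 2)))
  refl
  where x = var zero; y = var (suc zero)

-- Equal biquadratic forms give equal sums of fourth powers, since each
-- side exceeds (a - b)⁴ + (c - d)⁴ by eight times the common value.
equal-biquadratics⇒quartic : ∀ a b c d → biquadratic a b ≡ biquadratic c d →
  (a + b) ^ 4 + (c - d) ^ 4 ≡ (a - b) ^ 4 + (c + d) ^ 4
equal-biquadratics⇒quartic a b c d ab≡cd = begin
  (a + b) ^ 4 + (c - d) ^ 4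
    ≡⟨ cong (_+ (c - d) ^ 4) (sum⁴≡difference⁴+8biquadratic a b) ⟩
  (a - b) ^ 4 + 8 * biquadratic a b + (c - d) ^ 4
    ≡⟨ cong (λ t → (a - b) ^ 4 + 8 * t + (c - d) ^ 4) ab≡cd ⟩
  (a - b) ^ 4 + 8 * biquadratic c d + (c - d) ^ 4
    ≡⟨ +-assoc ((a - b) ^ 4) _ _ ⟩
  (a - b) ^ 4 + (8 * biquadratic c d + (c - d) ^ 4)
    ≡⟨ cong (λ t → (a - b) ^ 4 + t) (+-comm _ ((c - d) ^ 4)) ⟩
  (a - b) ^ 4 + ((c - d) ^ 4 + 8 * biquadratic c d)
    ≡⟨ cong (λ t → (a - b) ^ 4 + t) (sym (sum⁴≡difference⁴+8biquadratic c d)) ⟩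
  (a - b) ^ 4 + (c + d) ^ 4
    ∎
  where open ≡-Reasoning

mainTheorem4 : (n : ℚ) →
    (pP n * qQ n * (pP n ^ 2 + qQ n ^ 2) ≡ rR n * sS n * (rR n ^ 2 + sS n ^ 2))
    × ((pP n + qQ n) ^ 4 + (rR n - sS n) ^ 4 ≡ (pP n - qQ n) ^ 4 + (rR n + sS n) ^ 4)
mainTheorem4 n =
  biquadratic-pq≡rs n ,
  equal-biquadratics⇒quartic (pP n) (qQ n) (rR n) (sS n) (biquadratic-pq≡rs n)
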